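{- Let $K$ be a number field of degree $n$ and discriminant $d$, with ring of integers $\mathcal{O}_K$, and let $m$ be the positive integer with $\operatorname{Tr}_{K/\mathbb{Q}}(\mathcal{O}_K)=m\mathbb{Z}$. Then the discriminant of the quadratic form $\Phi_K(\alpha)=\tfrac12\operatorname{Tr}_{K/\mathbb{Q}}(\alpha^2)$ on $\mathcal{O}_K^{0}=\{\alpha\in\mathcal{O}_K:\operatorname{Tr}_{K/\mathbb{Q}}(\alpha)=0\}$ equals $(-1)^{\frac{(n-1)(n-2)}{2}}\frac{dn}{m^2}$. In particular, if $d$ is not divisible by the $n$th power of any integer bigger than $1$, then the discriminant of $\Phi_K$ equals $(-1)^{\frac{(n-1)(n-2)}{2}}dn$.
   Context: $\mathcal{O}_K^0$ is a free $\mathbb{Z}$-module of rank $n-1$. For a quadratic form $\Phi$ on a free $\mathbb{Z}$-module of rank $r$ with associated bilinear form $\phi(\alpha,\beta)=\Phi(\alpha+\beta)-\Phi(\alpha)-\Phi(\beta)$ (here $\phi(\alpha,\beta)=\operatorname{Tr}_{K/\mathbb{Q}}(\alpha\beta)$), the discriminant of $\Phi$ is $(-1)^{r(r-1)/2}\det(A)$ where $A=(\phi(\alpha_i,\alpha_j))_{i,j}$ for any $\mathbb{Z}$-basis $(\alpha_i)$. -}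

module Defs where

open import Data.Nat as ℕ using (ℕ; zero; suc; _∸_)
open import Data.Integer as ℤ using (ℤ; +_; _+_; _*_; -_)
open import Data.Integer.Divisibility using (_∣_)
open import Data.Fin using (Fin; toℕ; punchIn; _≟_)
import Data.Fin as Fin
open import Data.Sum using (_⊎_)
open import Data.Product using (Σ; ∃; _×_)
open import Relation.Nullary using (¬_; yes; no)
open import Relation.Binary.PropositionalEquality using (_≡_)

sumFin : ∀ n → (Fin n → ℤ) → ℤ
sumFin zero    f = + 0
sumFin (suc n) f = f Fin.zero + sumFin n (λ i → f (Fin.suc i))

negOnePow : ℕ → ℤ
negOnePow zero    = + 1
negOnePow (suc k) = - negOnePow k

det : ∀ n → (Fin n → Fin n → ℤ) → ℤ
det zero    M = + 1
det (suc n) M = sumFin (suc n) λ j →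
  negOnePow (toℕ j) * (M Fin.zero j * det n (λ r c → M (Fin.suc r) (punchIn j c)))

-- discriminant of a quadratic form on a free ℤ-module of rank r, given the
-- Gram matrix A = (φ(αᵢ,αⱼ)) of its associated bilinear form in a ℤ-basis:
-- (-1)^(r(r-1)/2) det A
discQF : ∀ r → (Fin r → Fin r → ℤ) → ℤ
discQF r A = negOnePow ((r ℕ.* (r ∸ 1)) ℕ./ 2) * det r A

Vecℤ : ℕ → Set
Vecℤ n = Fin n → ℤ

_≐_ : ∀ {n} → Vecℤ n → Vecℤ n → Set
x ≐ y = ∀ i → x i ≡ y i

zeroV : ∀ {n} → Vecℤ n
zeroV _ = + 0

_+V_ : ∀ {n} → Vecℤ n → Vecℤ n → Vecℤ n
(x +V y) i = x i + y i

scaleV : ∀ {n} → ℤ → Vecℤ n → Vecℤ n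
scaleV a x i = a * x i

basisV : ∀ {n} → Fin n → Vecℤ n
basisV i j with i ≟ j
... | yes _ = + 1
... | no  _ = + 0

linComb : ∀ {n r} → (Fin r → Vecℤ n) → (Fin r → ℤ) → Vecℤ n
linComb {n} {r} b c i = sumFin r λ k → c k * b k i

-- Structure constants: eᵢ eⱼ = Σₖ C i j k eₖ
StructConst : ℕ → Set
StructConst n = Fin n → Fin n → Fin n → ℤ

mulC : ∀ {n} → StructConst n → Vecℤ n → Vecℤ n → Vecℤ n
mulC {n} C x y k = sumFin n λ i → sumFin n λ j → x i * (y j * C i j k)

powC : ∀ {n} → StructConst n → Vecℤ n → Vecℤ n → ℕ → Vecℤ n
powC C one x zero    = one
powC C one x (suc j) = mulC C x (powC C one x j)

-- For y ∈ ℤⁿ, N > 0, monic integer polynomial Xᵏ + Σ_{j<k} aⱼ Xʲ: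
-- N^k · p(y/N) = yᵏ + Σ_{j<k} aⱼ N^(k-j) yʲ  (computed in ℤⁿ)
scaledPolyEval : ∀ {n} → StructConst n → Vecℤ n →
                 (k : ℕ) → (Fin k → ℤ) → ℕ → Vecℤ n → Vecℤ n
scaledPolyEval {n} C one k a N y =
  powC C one y k +V
  (λ i → sumFin k λ j → a j * ((+ (N ℕ.^ (k ∸ toℕ j))) * powC C one y (toℕ j) i))

-- The ring of integers O_K of a number field K of degree n, presented by a
-- ℤ-basis e₀,…,e_{n-1} and its multiplication table.
-- K = O ⊗ ℚ = ℚⁿ with the induced multiplication.
record RingOfIntegers (n : ℕ) : Set where
  field
    C        : StructConst n
    one      : Vecℤ n
    comm     : ∀ x y → mulC C x y ≐ mulC C y x
    assoc    : ∀ x y z → mulC C (mulC C x y) z ≐ mulC C x (mulC C y z)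
    identity : ∀ x → mulC C one x ≐ x
    nontrivial : ¬ (one ≐ zeroV)
    -- integral domain (so K = O ⊗ ℚ is a field, of degree n over ℚ)
    domain   : ∀ x y → mulC C x y ≐ zeroV → (x ≐ zeroV) ⊎ (y ≐ zeroV)
    -- integrally closed in K: if y/N (y ∈ ℤⁿ, N > 0) is a root of a monic
    -- polynomial with integer coefficients, then y/N ∈ O, i.e. N ∣ y.
    maximal  : ∀ (k : ℕ) (a : Fin k → ℤ) (N : ℕ) (y : Vecℤ n) →
               0 ℕ.< N → scaledPolyEval C one k a N y ≐ zeroV →
               ∀ i → (+ N) ∣ y i

module _ {n : ℕ} (O : RingOfIntegers n) where
  open RingOfIntegers O

  Tr : Vecℤ n → ℤ
  Tr x = sumFin n λ i → mulC C x (basisV i) i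

  discK : ℤ
  discK = det n λ i j → Tr (mulC C (basisV i) (basisV j))

  record IsTraceZeroBasis {r : ℕ} (b : Fin r → Vecℤ n) : Set where
    field
      inTraceZero : ∀ k → Tr (b k) ≡ + 0
      spans       : ∀ α → Tr α ≡ + 0 → ∃ λ c → α ≐ linComb b c
      independent : ∀ c → linComb b c ≐ zeroV → ∀ k → c k ≡ + 0

  -- discriminant of Φ_K(α) = ½ Tr(α²) on O_K^0 in the basis b; its
  -- associated bilinear form is φ(α,β) = Tr(αβ)
  discΦ : ∀ {r} → (Fin r → Vecℤ n) → ℤ
  discΦ {r} b = discQF r λ i j → Tr (mulC C (b i) (b j))

{-# OPTIONS --safe #-}
module Submission where

-- Choose x₀ ∈ O_K with Tr x₀ = m. Every y ∈ O_K is (Tr y / m)·x₀ plus an element of O_K⁰, so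
-- x₀, b₁, …, b_k is a ℤ-basis of O_K and its determinant is ±1. Writing 1 = s·x₀ + Σ cᵢbᵢ, the
-- trace gives s·m = n, and the family 1, b₁, …, b_k has determinant ±s. Its trace Gram matrix has
-- first row (n, 0, …, 0), so its determinant is n·det(Tr bᵢbⱼ) on the one hand and s²·d on the
-- other; cancelling s gives m²·det(Tr bᵢbⱼ) = d·n. Finally m divides every entry Tr(eᵢeⱼ), so
-- mⁿ ∣ d, which forces m = 1 when d is free of n-th powers.
--
-- Multiplicativity of det and its invariance under transposition come from the characterisation
-- of det as the unique column-linear alternating functional with det 1 = 1.

open import Defs
open import Data.Empty using (⊥-elim)
open import Data.Fin using (Fin; zero; suc; toℕ; punchIn; punchOut; inject₁; fromℕ<; _≟_)
open import Data.Fin.Permutation.Components using (transpose)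
open import Data.Fin.Properties
  using (suc-injective; toℕ-injective; toℕ-inject₁; toℕ-fromℕ<; toℕ<n; punchIn-injective;
         punchInᵢ≢i; punchIn-punchOut; punchOut-injective; pigeonhole; any?)
open import Data.Integer as ℤ using (ℤ; +_; _+_; _*_; -_; _-_)
open import Data.Integer.Divisibility using (_∣_)
import Data.Integer.Divisibility.Signed as Signed
import Data.Integer.Properties as ℤ
open import Data.Integer.Tactic.RingSolver using (solve-∀)
open import Data.Nat using (ℕ; zero; suc; _∸_; _/_; _<_; _≤_; _^_)
import Data.Nat as ℕ
import Data.Nat.Divisibility as ℕ
import Data.Nat.Properties as ℕ
open import Data.Product using (_×_; ∃; _,_; proj₁; proj₂)
open import Data.Vec.Functional using (_∷_)
open import Function using (_∘_)
open import Relation.Binary using (tri<; tri≈; tri>)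
open import Relation.Binary.PropositionalEquality
  using (_≡_; _≢_; refl; sym; trans; cong; cong₂; subst; module ≡-Reasoning)
open import Relation.Nullary using (¬_; Dec; yes; no)

open import Algebra.Properties.AbelianGroup ℤ.+-0-abelianGroup using (inverseʳ-unique)
open import Algebra.Properties.CommutativeSemigroup ℤ.+-commutativeSemigroup using (interchange)

-- Finite sums

sumFin-cong : ∀ n {f g : Fin n → ℤ} → (∀ i → f i ≡ g i) → sumFin n f ≡ sumFin n g
sumFin-cong zero    f≗g = refl
sumFin-cong (suc n) f≗g = cong₂ _+_ (f≗g zero) (sumFin-cong n (f≗g ∘ suc))

sumFin-+ : ∀ n (f g : Fin n → ℤ) → sumFin n (λ i → f i + g i) ≡ sumFin n f + sumFin n g
sumFin-+ zero    f g = refl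
sumFin-+ (suc n) f g = trans (cong (_+_ (f zero + g zero)) (sumFin-+ n (f ∘ suc) (g ∘ suc)))
                             (interchange (f zero) (g zero) _ _)

sumFin-*ˡ : ∀ n a (f : Fin n → ℤ) → sumFin n (λ i → a * f i) ≡ a * sumFin n f
sumFin-*ˡ zero    a f = sym (ℤ.*-zeroʳ a)
sumFin-*ˡ (suc n) a f = trans (cong (_+_ (a * f zero)) (sumFin-*ˡ n a (f ∘ suc)))
                              (sym (ℤ.*-distribˡ-+ a (f zero) (sumFin n (f ∘ suc))))

sumFin-*ʳ : ∀ n (f : Fin n → ℤ) a → sumFin n (λ i → f i * a) ≡ sumFin n f * a
sumFin-*ʳ zero    f a = sym (ℤ.*-zeroˡ a)
sumFin-*ʳ (suc n) f a = trans (cong (_+_ (f zero * a)) (sumFin-*ʳ n (f ∘ suc) a))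
                              (sym (ℤ.*-distribʳ-+ a (f zero) (sumFin n (f ∘ suc))))

sumFin-linear : ∀ n a (f g : Fin n → ℤ) →
                sumFin n (λ i → a * f i + g i) ≡ a * sumFin n f + sumFin n g
sumFin-linear n a f g = trans (sumFin-+ n (λ i → a * f i) g) (cong (_+ sumFin n g) (sumFin-*ˡ n a f))

sumFin-zeros : ∀ n {f : Fin n → ℤ} → (∀ i → f i ≡ + 0) → sumFin n f ≡ + 0
sumFin-zeros zero    f≗0 = refl
sumFin-zeros (suc n) f≗0 = cong₂ _+_ (f≗0 zero) (sumFin-zeros n (f≗0 ∘ suc))

sumFin-ones : ∀ n → sumFin n (λ _ → + 1) ≡ + n
sumFin-ones zero    = refl
sumFin-ones (suc n) = cong (_+_ (+ 1)) (sumFin-ones n)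

sumFin-swap : ∀ n m (f : Fin n → Fin m → ℤ) →
              sumFin n (λ i → sumFin m (f i)) ≡ sumFin m (λ j → sumFin n (λ i → f i j))
sumFin-swap zero    m f = sym (sumFin-zeros m (λ _ → refl))
sumFin-swap (suc n) m f = trans (cong (_+_ (sumFin m (f zero))) (sumFin-swap n m (f ∘ suc)))
                                (sym (sumFin-+ m (f zero) _))

sumFin-single : ∀ n (f : Fin n → ℤ) j → (∀ i → i ≢ j → f i ≡ + 0) → sumFin n f ≡ f j
sumFin-single (suc n) f zero    f≡0 =
  trans (cong (_+_ (f zero)) (sumFin-zeros n (λ i → f≡0 (suc i) λ ()))) (ℤ.+-identityʳ _)
sumFin-single (suc n) f (suc j) f≡0 =
  trans (cong₂ _+_ (f≡0 zero λ ())
                   (sumFin-single n (f ∘ suc) j (λ i i≢j → f≡0 (suc i) (i≢j ∘ suc-injective))))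
        (ℤ.+-identityˡ _)

sumFin-pair : ∀ n (f : Fin n → ℤ) p q → p ≢ q → (∀ i → i ≢ p → i ≢ q → f i ≡ + 0) →
              sumFin n f ≡ f p + f q
sumFin-pair (suc n) f zero    zero    p≢q f≡0 = ⊥-elim (p≢q refl)
sumFin-pair (suc n) f zero    (suc q) p≢q f≡0 =
  cong (_+_ (f zero)) (sumFin-single n (f ∘ suc) q (λ i i≢q → f≡0 (suc i) (λ ()) (i≢q ∘ suc-injective)))
sumFin-pair (suc n) f (suc p) zero    p≢q f≡0 =
  trans (cong (_+_ (f zero))
              (sumFin-single n (f ∘ suc) p (λ i i≢p → f≡0 (suc i) (i≢p ∘ suc-injective) (λ ()))))
        (ℤ.+-comm (f zero) _)
sumFin-pair (suc n) f (suc p) (suc q) p≢q f≡0 =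
  trans (cong₂ _+_ (f≡0 zero (λ ()) (λ ()))
                   (sumFin-pair n (f ∘ suc) p q (p≢q ∘ cong suc)
                      (λ i i≢p i≢q → f≡0 (suc i) (i≢p ∘ suc-injective) (i≢q ∘ suc-injective))))
        (ℤ.+-identityˡ _)

∣-sumFin : ∀ n {d} (f : Fin n → ℤ) → (∀ i → d Signed.∣ f i) → d Signed.∣ sumFin n f
∣-sumFin zero {d} f d∣f = Signed.divides (+ 0) (sym (ℤ.*-zeroˡ d))
∣-sumFin (suc n) f d∣f = Signed.∣m∣n⇒∣m+n (d∣f zero) (∣-sumFin n (f ∘ suc) (d∣f ∘ suc))

basisV-diag : ∀ {n} (i : Fin n) → basisV i i ≡ + 1
basisV-diag i with i ≟ i
... | yes _   = refl
... | no  i≢i = ⊥-elim (i≢i refl)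

basisV-offDiag : ∀ {n} {i j : Fin n} → i ≢ j → basisV i j ≡ + 0
basisV-offDiag {i = i} {j} i≢j with i ≟ j
... | yes i≡j = ⊥-elim (i≢j i≡j)
... | no  _   = refl

basisV-sym : ∀ {n} (i j : Fin n) → basisV i j ≡ basisV j i
basisV-sym i j = by-cases (i ≟ j)
  where
  by-cases : Dec (i ≡ j) → basisV i j ≡ basisV j i
  by-cases (yes refl) = refl
  by-cases (no i≢j)   = trans (basisV-offDiag i≢j) (sym (basisV-offDiag (i≢j ∘ sym)))

basisV-suc : ∀ {n} (i j : Fin n) → basisV (suc i) (suc j) ≡ basisV i j
basisV-suc i j = by-cases (i ≟ j)
  where
  by-cases : Dec (i ≡ j) → basisV (suc i) (suc j) ≡ basisV i j
  by-cases (yes refl) = trans (basisV-diag (suc i)) (sym (basisV-diag i))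
  by-cases (no i≢j)   = trans (basisV-offDiag (i≢j ∘ suc-injective)) (sym (basisV-offDiag i≢j))

sumFin-*basisV : ∀ n (x : Fin n → ℤ) j → sumFin n (λ i → x i * basisV i j) ≡ x j
sumFin-*basisV n x j =
  trans (sumFin-single n _ j (λ i i≢j → trans (cong (x i *_) (basisV-offDiag i≢j)) (ℤ.*-zeroʳ (x i))))
        (trans (cong (x j *_) (basisV-diag j)) (ℤ.*-identityʳ (x j)))

sumFin-basisV* : ∀ n (x : Fin n → ℤ) j → sumFin n (λ i → basisV j i * x i) ≡ x j
sumFin-basisV* n x j =
  trans (sumFin-cong n (λ i → trans (ℤ.*-comm (basisV j i) (x i)) (cong (x i *_) (basisV-sym j i))))
        (sumFin-*basisV n x j)

-- Determinants

Matrix : ℕ → Set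
Matrix n = Fin n → Fin n → ℤ

infix  4 _≗ᴹ_
infixl 7 _*ᴹ_
infix  8 _ᵀ

_≗ᴹ_ : ∀ {n} → Matrix n → Matrix n → Set
M ≗ᴹ N = ∀ r c → M r c ≡ N r c

1ᴹ : ∀ n → Matrix n
1ᴹ n r c = basisV r c

_*ᴹ_ : ∀ {n} → Matrix n → Matrix n → Matrix n
(A *ᴹ B) r c = sumFin _ (λ i → A r i * B i c)

_ᵀ : ∀ {n} → Matrix n → Matrix n
(A ᵀ) r c = A c r

minor : ∀ {n} → Matrix (suc n) → Fin (suc n) → Matrix n
minor M j r c = M (suc r) (punchIn j c)

laplaceTerm : ∀ {n} → Matrix (suc n) → Fin (suc n) → ℤ
laplaceTerm {n} M j = negOnePow (toℕ j) * (M zero j * det n (minor M j))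

Extensional : ∀ n → (Matrix n → ℤ) → Set
Extensional n D = ∀ M N → M ≗ᴹ N → D M ≡ D N

ColumnLinear : ∀ n → (Matrix n → ℤ) → Set
ColumnLinear n D = ∀ j a (M U V : Matrix n) →
  (∀ r c → c ≢ j → U r c ≡ M r c) → (∀ r c → c ≢ j → V r c ≡ M r c) →
  (∀ r → M r j ≡ a * U r j + V r j) → D M ≡ a * D U + D V

RowLinear : ∀ n → (Matrix n → ℤ) → Set
RowLinear n D = ∀ i a (M U V : Matrix n) →
  (∀ r c → r ≢ i → U r c ≡ M r c) → (∀ r c → r ≢ i → V r c ≡ M r c) →
  (∀ c → M i c ≡ a * U i c + V i c) → D M ≡ a * D U + D V

ColumnAlternating : ∀ n → (Matrix n → ℤ) → Set
ColumnAlternating n D = ∀ M (i l : Fin n) → i ≢ l → (∀ r → M r i ≡ M r l) → D M ≡ + 0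

det-cong : ∀ n → Extensional n (det n)
det-cong zero    M N M≗N = refl
det-cong (suc n) M N M≗N = sumFin-cong (suc n) λ j →
  cong₂ (λ x y → negOnePow (toℕ j) * (x * y))
        (M≗N zero j) (det-cong n (minor M j) (minor N j) (λ r c → M≗N (suc r) (punchIn j c)))

laplaceTerm-zeroEntry : ∀ {n} (M : Matrix (suc n)) j → M zero j ≡ + 0 → laplaceTerm M j ≡ + 0
laplaceTerm-zeroEntry {n} M j M₀ⱼ≡0 =
  trans (cong (λ x → negOnePow (toℕ j) * (x * det n (minor M j))) M₀ⱼ≡0) (ℤ.*-zeroʳ (negOnePow (toℕ j)))

laplaceTerm-zeroMinor : ∀ {n} (M : Matrix (suc n)) j → det n (minor M j) ≡ + 0 → laplaceTerm M j ≡ + 0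
laplaceTerm-zeroMinor M j minor≡0 =
  trans (cong (λ x → negOnePow (toℕ j) * (M zero j * x)) minor≡0)
        (trans (cong (negOnePow (toℕ j) *_) (ℤ.*-zeroʳ (M zero j))) (ℤ.*-zeroʳ (negOnePow (toℕ j))))

det-linear-byTerms : ∀ {n} a (M U V : Matrix (suc n)) →
             (∀ j → laplaceTerm M j ≡ a * laplaceTerm U j + laplaceTerm V j) →
             det (suc n) M ≡ a * det (suc n) U + det (suc n) V
det-linear-byTerms {n} a M U V terms =
  trans (sumFin-cong (suc n) terms) (sumFin-linear (suc n) a (laplaceTerm U) (laplaceTerm V))

laplaceTerm-linearInEntry : ∀ {n} a (M U V : Matrix (suc n)) j →
  M zero j ≡ a * U zero j + V zero j → minor M j ≗ᴹ minor U j → minor V j ≗ᴹ minor U j →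
  laplaceTerm M j ≡ a * laplaceTerm U j + laplaceTerm V j
laplaceTerm-linearInEntry {n} a M U V j M₀ⱼ M≗U V≗U = begin
  σ * (M zero j * det n (minor M j))
    ≡⟨ cong₂ (λ x y → σ * (x * y)) M₀ⱼ (det-cong n _ _ M≗U) ⟩
  σ * ((a * U zero j + V zero j) * det n (minor U j))
    ≡⟨ distrib σ a (U zero j) (V zero j) (det n (minor U j)) ⟩
  a * (σ * (U zero j * det n (minor U j))) + σ * (V zero j * det n (minor U j))
    ≡⟨ cong (λ x → a * laplaceTerm U j + σ * (V zero j * x)) (det-cong n _ _ V≗U) ⟨
  a * laplaceTerm U j + laplaceTerm V j ∎
  where
  open ≡-Reasoning
  σ = negOnePow (toℕ j)
  distrib : ∀ s a u v d → s * ((a * u + v) * d) ≡ a * (s * (u * d)) + s * (v * d)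
  distrib = solve-∀

laplaceTerm-linearInMinor : ∀ {n} a (M U V : Matrix (suc n)) j →
  U zero j ≡ M zero j → V zero j ≡ M zero j →
  det n (minor M j) ≡ a * det n (minor U j) + det n (minor V j) →
  laplaceTerm M j ≡ a * laplaceTerm U j + laplaceTerm V j
laplaceTerm-linearInMinor {n} a M U V j U₀ⱼ V₀ⱼ minor-linear = begin
  σ * (M zero j * det n (minor M j))
    ≡⟨ cong (λ x → σ * (M zero j * x)) minor-linear ⟩
  σ * (M zero j * (a * det n (minor U j) + det n (minor V j)))
    ≡⟨ distrib σ (M zero j) a (det n (minor U j)) (det n (minor V j)) ⟩
  a * (σ * (M zero j * det n (minor U j))) + σ * (M zero j * det n (minor V j))
    ≡⟨ cong₂ (λ x y → a * (σ * (x * det n (minor U j))) + σ * (y * det n (minor V j))) U₀ⱼ V₀ⱼ ⟨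
  a * laplaceTerm U j + laplaceTerm V j ∎
  where
  open ≡-Reasoning
  σ = negOnePow (toℕ j)
  distrib : ∀ s x a u v → s * (x * (a * u + v)) ≡ a * (s * (x * u)) + s * (x * v)
  distrib = solve-∀

det-columnLinear : ∀ n → ColumnLinear n (det n)
det-columnLinear (suc n) j a M U V U≈M V≈M Mⱼ = det-linear-byTerms a M U V term
  where
  term : ∀ c → laplaceTerm M c ≡ a * laplaceTerm U c + laplaceTerm V c
  term c with c ≟ j
  ... | yes refl = laplaceTerm-linearInEntry a M U V c (Mⱼ zero)
    (λ r x → sym (U≈M (suc r) (punchIn c x) (punchInᵢ≢i c x)))
    (λ r x → trans (V≈M (suc r) (punchIn c x) (punchInᵢ≢i c x))
                   (sym (U≈M (suc r) (punchIn c x) (punchInᵢ≢i c x))))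
  ... | no  c≢j  = laplaceTerm-linearInMinor a M U V c (U≈M zero c c≢j) (V≈M zero c c≢j)
    (det-columnLinear n j′ a (minor M c) (minor U c) (minor V c)
      (λ r x x≢j′ → U≈M (suc r) (punchIn c x) (avoids x x≢j′))
      (λ r x x≢j′ → V≈M (suc r) (punchIn c x) (avoids x x≢j′))
      (λ r → subst (λ y → M (suc r) y ≡ a * U (suc r) y + V (suc r) y)
                   (sym (punchIn-punchOut c≢j)) (Mⱼ (suc r))))
    where
    j′ = punchOut c≢j
    avoids : ∀ x → x ≢ j′ → punchIn c x ≢ j
    avoids x x≢j′ eq = x≢j′ (punchIn-injective c x j′ (trans eq (sym (punchIn-punchOut c≢j))))

det-rowLinear : ∀ n → RowLinear n (det n)
det-rowLinear (suc n) zero a M U V U≈M V≈M M₀ = det-linear-byTerms a M U V λ c →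
  laplaceTerm-linearInEntry a M U V c (M₀ c)
    (λ r x → sym (U≈M (suc r) (punchIn c x) λ ()))
    (λ r x → trans (V≈M (suc r) (punchIn c x) λ ()) (sym (U≈M (suc r) (punchIn c x) λ ())))
det-rowLinear (suc n) (suc i) a M U V U≈M V≈M Mᵢ = det-linear-byTerms a M U V λ c →
  laplaceTerm-linearInMinor a M U V c (U≈M zero c λ ()) (V≈M zero c λ ())
    (det-rowLinear n i a (minor M c) (minor U c) (minor V c)
      (λ r x r≢i → U≈M (suc r) (punchIn c x) (r≢i ∘ suc-injective))
      (λ r x r≢i → V≈M (suc r) (punchIn c x) (r≢i ∘ suc-injective))
      (λ x → Mᵢ (punchIn c x)))

setColumn : ∀ {n} → Matrix n → Fin n → (Fin n → ℤ) → Matrix n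
setColumn M j w r c with c ≟ j
... | yes _ = w r
... | no  _ = M r c

setColumn-≡ : ∀ {n} (M : Matrix n) j w r → setColumn M j w r j ≡ w r
setColumn-≡ M j w r with j ≟ j
... | yes _   = refl
... | no  j≢j = ⊥-elim (j≢j refl)

setColumn-≢ : ∀ {n} (M : Matrix n) {j} w r {c} → c ≢ j → setColumn M j w r c ≡ M r c
setColumn-≢ M {j} w r {c} c≢j with c ≟ j
... | yes c≡j = ⊥-elim (c≢j c≡j)
... | no  _   = refl

setColumn-linear : ∀ {n} {D : Matrix n → ℤ} → ColumnLinear n D → ∀ M j a u v →
  D (setColumn M j (λ r → a * u r + v r)) ≡ a * D (setColumn M j u) + D (setColumn M j v)
setColumn-linear D-lin M j a u v = D-lin j a _ _ _
  (λ r c c≢j → trans (setColumn-≢ M u r c≢j) (sym (setColumn-≢ M _ r c≢j)))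
  (λ r c c≢j → trans (setColumn-≢ M v r c≢j) (sym (setColumn-≢ M _ r c≢j)))
  (λ r → trans (setColumn-≡ M j _ r)
               (cong₂ (λ x y → a * x + y) (sym (setColumn-≡ M j u r)) (sym (setColumn-≡ M j v r))))

columnLinear-zeroColumn : ∀ {n} {D : Matrix n → ℤ} → ColumnLinear n D →
                          ∀ M j → (∀ r → M r j ≡ + 0) → D M ≡ + 0
columnLinear-zeroColumn {D = D} D-lin M j Mⱼ≡0 =
  trans (D-lin j (- + 1) M M M (λ _ _ _ → refl) (λ _ _ _ → refl)
               (λ r → trans (Mⱼ≡0 r) (sym (cong (λ x → - + 1 * x + x) (Mⱼ≡0 r)))))
        (cancel (D M))
  where
  cancel : ∀ x → - + 1 * x + x ≡ + 0
  cancel = solve-∀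

setColumn-sumFin : ∀ {n} {D : Matrix n → ℤ} → ColumnLinear n D →
  ∀ M j s (a : Fin s → ℤ) (w : Fin s → Fin n → ℤ) →
  D (setColumn M j (λ r → sumFin s (λ t → a t * w t r))) ≡ sumFin s (λ t → a t * D (setColumn M j (w t)))
setColumn-sumFin D-lin M j zero    a w = columnLinear-zeroColumn D-lin _ j (setColumn-≡ M j _)
setColumn-sumFin {D = D} D-lin M j (suc s) a w =
  trans (setColumn-linear D-lin M j (a zero) (w zero) _)
        (cong (_+_ (a zero * D (setColumn M j (w zero)))) (setColumn-sumFin D-lin M j s (a ∘ suc) (w ∘ suc)))

transpose-ˡ : ∀ {n} (i j : Fin n) → transpose i j i ≡ j
transpose-ˡ i j with i ≟ i
... | yes _   = refl
... | no  i≢i = ⊥-elim (i≢i refl)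

transpose-ʳ : ∀ {n} (i j : Fin n) → transpose i j j ≡ i
transpose-ʳ i j with j ≟ i
... | yes j≡i = j≡i
... | no  _ with j ≟ j
...   | yes _   = refl
...   | no  j≢j = ⊥-elim (j≢j refl)

transpose-≢ : ∀ {n} {i j k : Fin n} → k ≢ i → k ≢ j → transpose i j k ≡ k
transpose-≢ {i = i} {j} {k} k≢i k≢j with k ≟ i
... | yes k≡i = ⊥-elim (k≢i k≡i)
... | no  _ with k ≟ j
...   | yes k≡j = ⊥-elim (k≢j k≡j)
...   | no  _   = refl

transpose-involutive : ∀ {n} (i j k : Fin n) → transpose i j (transpose i j k) ≡ k
transpose-involutive i j k = by-cases (k ≟ i) (k ≟ j)
  where
  by-cases : Dec (k ≡ i) → Dec (k ≡ j) → transpose i j (transpose i j k) ≡ k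
  by-cases (yes refl) _          = trans (cong (transpose k j) (transpose-ˡ k j)) (transpose-ʳ k j)
  by-cases (no _)     (yes refl) = trans (cong (transpose i k) (transpose-ʳ i k)) (transpose-ˡ i k)
  by-cases (no k≢i)   (no k≢j)   = trans (cong (transpose i j) (transpose-≢ k≢i k≢j)) (transpose-≢ k≢i k≢j)

swapColumns : ∀ {n} → Matrix n → Fin n → Fin n → Matrix n
swapColumns M p q r c = M r (transpose p q c)

-- Columns p and q enter D through a bilinear form that vanishes on the diagonal, hence is
-- antisymmetric.
module _ {n} {D : Matrix n → ℤ} (D-ext : Extensional n D) (D-lin : ColumnLinear n D)
         {p q : Fin n} (p≢q : p ≢ q) (D-alt : ∀ M → (∀ r → M r p ≡ M r q) → D M ≡ + 0)
         (M : Matrix n) where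

  private
    K : (u v : Fin n → ℤ) → Matrix n
    K u v = setColumn (setColumn M q v) p u

    B : (u v : Fin n → ℤ) → ℤ
    B u v = D (K u v)

    K-column-q : ∀ u v r → K u v r q ≡ v r
    K-column-q u v r = trans (setColumn-≢ _ u r (p≢q ∘ sym)) (setColumn-≡ M q v r)

    K-off-q : ∀ u v v′ r c → c ≢ q → K u v r c ≡ K u v′ r c
    K-off-q u v v′ r c c≢q with c ≟ p
    ... | yes _ = refl
    ... | no  _ = trans (setColumn-≢ M v r c≢q) (sym (setColumn-≢ M v′ r c≢q))

    B-diag : ∀ s → B s s ≡ + 0
    B-diag s = D-alt _ λ r → trans (setColumn-≡ _ p s r) (sym (K-column-q s s r))

    B-linearˡ : ∀ a u u′ v → B (λ r → a * u r + u′ r) v ≡ a * B u v + B u′ v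
    B-linearˡ a u u′ v = setColumn-linear D-lin (setColumn M q v) p a u u′

    B-linearʳ : ∀ a u v v′ → B u (λ r → a * v r + v′ r) ≡ a * B u v + B u v′
    B-linearʳ a u v v′ = D-lin q a _ _ _ (λ r c → K-off-q u v _ r c) (λ r c → K-off-q u v′ _ r c)
      (λ r → trans (K-column-q u _ r) (sym (cong₂ (λ x y → a * x + y) (K-column-q u v r) (K-column-q u v′ r))))

    B-columns : ∀ (f : Fin n → Fin n) {x y} → f p ≡ x → f q ≡ y →
                (∀ c → c ≢ p → c ≢ q → f c ≡ c) →
                B (λ r → M r x) (λ r → M r y) ≡ D (λ r c → M r (f c))
    B-columns f {x} {y} fp fq fc = D-ext _ _ λ r c → by-cases r c (c ≟ p) (c ≟ q)
      where
      by-cases : ∀ r c → Dec (c ≡ p) → Dec (c ≡ q) → K (λ r → M r x) (λ r → M r y) r c ≡ M r (f c)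
      by-cases r c (yes refl) _          = trans (setColumn-≡ _ c _ r) (cong (M r) (sym fp))
      by-cases r c (no c≢p)   (yes refl) =
        trans (setColumn-≢ _ _ r c≢p) (trans (setColumn-≡ M c _ r) (cong (M r) (sym fq)))
      by-cases r c (no c≢p)   (no c≢q)   =
        trans (setColumn-≢ _ _ r c≢p) (trans (setColumn-≢ M _ r c≢q) (cong (M r) (sym (fc c c≢p c≢q))))

    u v s : Fin n → ℤ
    u r = M r p
    v r = M r q
    s r = + 1 * u r + v r

    B-antisymmetric : B u v + B v u ≡ + 0
    B-antisymmetric = begin
      B u v + B v u                                    ≡⟨ ℤ.+-identityʳ _ ⟨
      (B u v + B v u) + + 0
        ≡⟨ cong₂ (λ x y → (B u v + B v u) + (x + y)) (B-diag u) (B-diag v) ⟨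
      (B u v + B v u) + (B u u + B v v)                ≡⟨ expand (B u u) (B u v) (B v u) (B v v) ⟨
      + 1 * (+ 1 * B u u + B u v) + (+ 1 * B v u + B v v)
        ≡⟨ cong₂ (λ x y → + 1 * x + y) (B-linearʳ (+ 1) u u v) (B-linearʳ (+ 1) v u v) ⟨
      + 1 * B u s + B v s                              ≡⟨ B-linearˡ (+ 1) u v s ⟨
      B s s                                            ≡⟨ B-diag s ⟩
      + 0                                              ∎
      where
      open ≡-Reasoning
      expand : ∀ x y z w → + 1 * (+ 1 * x + y) + (+ 1 * z + w) ≡ (y + z) + (x + w)
      expand = solve-∀

  swapColumns-negates : D (swapColumns M p q) ≡ - D M
  swapColumns-negates = begin
    D (swapColumns M p q)
      ≡⟨ B-columns (transpose p q) (transpose-ˡ p q) (transpose-ʳ p q) (λ _ → transpose-≢) ⟨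
    B v u                  ≡⟨ inverseʳ-unique (B u v) (B v u) B-antisymmetric ⟩
    - B u v                ≡⟨ cong -_ (B-columns (λ c → c) refl refl (λ _ _ _ → refl)) ⟩
    - D M                  ∎
    where open ≡-Reasoning

inject₁≢suc : ∀ {n} (i : Fin n) → inject₁ i ≢ suc i
inject₁≢suc zero    ()
inject₁≢suc (suc i) eq = inject₁≢suc i (suc-injective eq)

punchIn-inject₁ : ∀ {n} (i c : Fin n) → c ≢ i → punchIn (inject₁ i) c ≡ punchIn (suc i) c
punchIn-inject₁ zero    zero    c≢i = ⊥-elim (c≢i refl)
punchIn-inject₁ zero    (suc c) c≢i = refl
punchIn-inject₁ (suc i) zero    c≢i = refl
punchIn-inject₁ (suc i) (suc c) c≢i = cong suc (punchIn-inject₁ i c (c≢i ∘ cong suc))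

punchIn-inject₁-self : ∀ {n} (i : Fin n) → punchIn (inject₁ i) i ≡ suc i
punchIn-inject₁-self zero    = refl
punchIn-inject₁-self (suc i) = cong suc (punchIn-inject₁-self i)

punchIn-suc-self : ∀ {n} (i : Fin n) → punchIn (suc i) i ≡ inject₁ i
punchIn-suc-self zero    = refl
punchIn-suc-self (suc i) = cong suc (punchIn-suc-self i)

-- Only the terms at the two equal columns survive; they have equal minors and opposite signs.
det-alternating-adjacent : ∀ n → ColumnAlternating n (det n) →
  ∀ (i : Fin n) M → (∀ r → M r (inject₁ i) ≡ M r (suc i)) → det (suc n) M ≡ + 0
det-alternating-adjacent n alt i M cols = begin
  det (suc n) M                      ≡⟨ sumFin-pair (suc n) (laplaceTerm M) p q (inject₁≢suc i) other-terms ⟩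
  laplaceTerm M p + laplaceTerm M q
    ≡⟨ cong₂ (λ k x → negOnePow k * (x * det n (minor M p)) + laplaceTerm M q) (toℕ-inject₁ i) (cols zero) ⟩
  σ * (M zero q * det n (minor M p)) + - σ * (M zero q * det n (minor M q))
    ≡⟨ cong (λ x → σ * (M zero q * x) + - σ * (M zero q * det n (minor M q))) (det-cong n _ _ same-minors) ⟩
  σ * X + - σ * X                    ≡⟨ cancel σ X ⟩
  + 0                                ∎
  where
  open ≡-Reasoning
  p q : Fin (suc n)
  p = inject₁ i
  q = suc i
  σ = negOnePow (toℕ i)
  X = M zero q * det n (minor M q)
  cancel : ∀ s x → s * x + - s * x ≡ + 0
  cancel = solve-∀
  same-minors : minor M p ≗ᴹ minor M q
  same-minors r c with c ≟ i
  ... | yes refl = trans (cong (M (suc r)) (punchIn-inject₁-self c))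
                         (trans (sym (cols (suc r))) (cong (M (suc r)) (sym (punchIn-suc-self c))))
  ... | no  c≢i  = cong (M (suc r)) (punchIn-inject₁ i c c≢i)
  other-terms : ∀ c → c ≢ p → c ≢ q → laplaceTerm M c ≡ + 0
  other-terms c c≢p c≢q = laplaceTerm-zeroMinor M c
    (alt (minor M c) (punchOut c≢p) (punchOut c≢q)
         (λ eq → inject₁≢suc i (trans (sym (punchIn-punchOut c≢p))
                                      (trans (cong (punchIn c) eq) (punchIn-punchOut c≢q))))
         (λ r → trans (cong (M (suc r)) (punchIn-punchOut c≢p))
                      (trans (cols (suc r)) (cong (M (suc r)) (sym (punchIn-punchOut c≢q))))))

module _ (n : ℕ) (alt : ColumnAlternating n (det n)) where

  private
    adjacent-swap-negates : ∀ (l : Fin n) M → det (suc n) (swapColumns M (inject₁ l) (suc l)) ≡ - det (suc n) M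
    adjacent-swap-negates l = swapColumns-negates (det-cong (suc n)) (det-columnLinear (suc n)) (inject₁≢suc l)
                                                  (det-alternating-adjacent n alt l)

  -- Swapping column l with its left neighbour moves the repeated column one step closer to i.
  det-alternating-atDistance : ∀ d (i l : Fin (suc n)) M → toℕ l ≡ suc (d ℕ.+ toℕ i) →
                               (∀ r → M r i ≡ M r l) → det (suc n) M ≡ + 0
  det-alternating-atDistance d       i zero     M () cols
  det-alternating-atDistance zero    i (suc l′) M eq cols =
    det-alternating-adjacent n alt l′ M (λ r → subst (λ j → M r j ≡ M r (suc l′)) i≡l′ (cols r))
    where
    i≡l′ : i ≡ inject₁ l′
    i≡l′ = toℕ-injective (trans (ℕ.suc-injective (sym eq)) (sym (toℕ-inject₁ l′)))
  det-alternating-atDistance (suc d) i (suc l′) M eq cols =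
    ℤ.neg-injective (trans (sym (adjacent-swap-negates l′ M))
                           (det-alternating-atDistance d i p (swapColumns M p q) toℕp≡ swapped-cols))
    where
    p q : Fin (suc n)
    p = inject₁ l′
    q = suc l′
    toℕp≡ : toℕ p ≡ suc (d ℕ.+ toℕ i)
    toℕp≡ = trans (toℕ-inject₁ l′) (ℕ.suc-injective eq)
    i≢p : i ≢ p
    i≢p i≡p = ℕ.m≢1+n+m (toℕ i) (trans (cong toℕ i≡p) toℕp≡)
    i≢q : i ≢ q
    i≢q i≡q = ℕ.m≢1+n+m (toℕ i) {suc d} (trans (cong toℕ i≡q) eq)
    swapped-cols : ∀ r → swapColumns M p q r i ≡ swapColumns M p q r p
    swapped-cols r = trans (cong (M r) (transpose-≢ i≢p i≢q))
                           (trans (cols r) (cong (M r) (sym (transpose-ˡ p q))))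

distance : ∀ {a b} → a < b → b ≡ suc ((b ∸ suc a) ℕ.+ a)
distance {a} {b} a<b = sym (trans (sym (ℕ.+-suc (b ∸ suc a) a)) (ℕ.m∸n+n≡m a<b))

det-columnAlternating : ∀ n → ColumnAlternating n (det n)
det-columnAlternating (suc n) M i l i≢l cols with ℕ.<-cmp (toℕ i) (toℕ l)
... | tri< i<l _ _ = det-alternating-atDistance n (det-columnAlternating n) _ i l M (distance i<l) cols
... | tri≈ _ i≡l _ = ⊥-elim (i≢l (toℕ-injective i≡l))
... | tri> _ _ l<i = det-alternating-atDistance n (det-columnAlternating n) _ l i M (distance l<i) (sym ∘ cols)

basisMatrix : ∀ {n} → (Fin n → Fin n) → Matrix n
basisMatrix g r c = basisV (g c) r

missing-value⇒collision : ∀ {n} (p : Fin n) (g : Fin n → Fin n) → (∀ l → g l ≢ p) →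
                          ∃ λ i → ∃ λ j → i ≢ j × g i ≡ g j
missing-value⇒collision {suc n} p g g≢p
  with pigeonhole (ℕ.n<1+n n) (λ c → punchOut (g≢p c ∘ sym))
... | i , j , i<j , eq =
  i , j , (λ i≡j → ℕ.<⇒≢ i<j (cong toℕ i≡j)) , punchOut-injective (g≢p i ∘ sym) (g≢p j ∘ sym) eq

≤∧≢⇒suc≤ : ∀ {n t} {p c : Fin n} → toℕ p ≡ t → t ≤ toℕ c → c ≢ p → suc t ≤ toℕ c
≤∧≢⇒suc≤ refl t≤c c≢p = ℕ.≤∧≢⇒< t≤c (λ eq → c≢p (toℕ-injective (sym eq)))

-- Expanding the columns one at a time reduces E to matrices whose columns are standard basis
-- vectors; such a matrix either repeats a column or is sorted to 1 by column swaps.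
module _ {n} {E : Matrix n → ℤ} (E-ext : Extensional n E) (E-lin : ColumnLinear n E)
         (E-alt : ColumnAlternating n E) (E-1 : E (1ᴹ n) ≡ + 0) where

  private
    FixesFrom : ℕ → (Fin n → Fin n) → Set
    FixesFrom t g = ∀ c → t ≤ toℕ c → g c ≡ c

    fix-one-more : ∀ t (p : Fin n) → toℕ p ≡ t → (∀ g → FixesFrom t g → E (basisMatrix g) ≡ + 0) →
                   ∀ g → FixesFrom (suc t) g → E (basisMatrix g) ≡ + 0
    fix-one-more t p p≡t IH g fix with g p ≟ p
    ... | yes gp≡p = IH g fix′
      where
      fix′ : FixesFrom t g
      fix′ c t≤c with c ≟ p
      ... | yes refl = gp≡p
      ... | no  c≢p  = fix c (≤∧≢⇒suc≤ p≡t t≤c c≢p)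
    ... | no gp≢p with any? (λ l → g l ≟ p)
    ...   | yes (l , gl≡p) =
      ℤ.neg-injective (trans (sym (swapColumns-negates E-ext E-lin p≢l (λ M → E-alt M p l p≢l) (basisMatrix g)))
                             (IH (g ∘ transpose p l) fix′))
      where
      p≢l : p ≢ l
      p≢l p≡l = gp≢p (trans (cong g p≡l) gl≡p)
      fix′ : FixesFrom t (g ∘ transpose p l)
      fix′ c t≤c = by-cases (c ≟ p)
        where
        by-cases : Dec (c ≡ p) → g (transpose p l c) ≡ c
        by-cases (yes refl) = trans (cong g (transpose-ˡ c l)) gl≡p
        by-cases (no c≢p)   = trans (cong g (transpose-≢ c≢p c≢l)) gc≡c
          where
          gc≡c : g c ≡ c
          gc≡c = fix c (≤∧≢⇒suc≤ p≡t t≤c c≢p)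
          c≢l : c ≢ l
          c≢l refl = c≢p (trans (sym gc≡c) gl≡p)
    ...   | no ∄l with missing-value⇒collision p g (λ l gl≡p → ∄l (l , gl≡p))
    ...     | i , j , i≢j , gi≡gj = E-alt (basisMatrix g) i j i≢j (λ r → cong (λ x → basisV x r) gi≡gj)

    vanishes-fixingFrom : ∀ t → t ≤ n → ∀ g → FixesFrom t g → E (basisMatrix g) ≡ + 0
    vanishes-fixingFrom zero    _   g fix =
      trans (E-ext _ _ λ r c → trans (cong (λ x → basisV x r) (fix c ℕ.z≤n)) (basisV-sym c r)) E-1
    vanishes-fixingFrom (suc t) t<n =
      fix-one-more t (fromℕ< t<n) (toℕ-fromℕ< t<n) (vanishes-fixingFrom t (ℕ.<⇒≤ t<n))

    AgreesFrom : ℕ → Matrix n → (Fin n → Fin n) → Set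
    AgreesFrom t A g = ∀ r c → t ≤ toℕ c → A r c ≡ basisMatrix g r c

    vanishes-agreeingFrom : ∀ t → t ≤ n → ∀ A g → AgreesFrom t A g → E A ≡ + 0
    vanishes-agreeingFrom zero    _   A g agree =
      trans (E-ext A (basisMatrix g) (λ r c → agree r c ℕ.z≤n))
            (vanishes-fixingFrom n ℕ.≤-refl g (λ c n≤c → ⊥-elim (ℕ.<⇒≱ (toℕ<n c) n≤c)))
    vanishes-agreeingFrom (suc t) t<n A g agree = begin
      E A                                                     ≡⟨ E-ext _ _ expand-column ⟩
      E (setColumn A p (λ r → sumFin n (λ i → A i p * basisV i r)))
        ≡⟨ setColumn-sumFin E-lin A p n (λ i → A i p) basisV ⟩
      sumFin n (λ i → A i p * E (setColumn A p (basisV i)))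
        ≡⟨ sumFin-zeros n (λ i → trans (cong (A i p *_) (vanishes-at i)) (ℤ.*-zeroʳ (A i p))) ⟩
      + 0                                                     ∎
      where
      open ≡-Reasoning
      p = fromℕ< t<n
      expand-column : ∀ r c → A r c ≡ setColumn A p (λ r → sumFin n (λ i → A i p * basisV i r)) r c
      expand-column r c with c ≟ p
      ... | yes refl = sym (sumFin-*basisV n (λ i → A i c) r)
      ... | no  _    = refl
      vanishes-at : ∀ i → E (setColumn A p (basisV i)) ≡ + 0
      vanishes-at i = vanishes-agreeingFrom t (ℕ.<⇒≤ t<n) _ g′ agree′
        where
        g′ : Fin n → Fin n
        g′ c with c ≟ p
        ... | yes _ = i
        ... | no  _ = g c
        agree′ : AgreesFrom t (setColumn A p (basisV i)) g′
        agree′ r c t≤c with c ≟ p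
        ... | yes _   = refl
        ... | no  c≢p = agree r c (≤∧≢⇒suc≤ (toℕ-fromℕ< t<n) t≤c c≢p)

  columnAlternating-vanishes : ∀ A → E A ≡ + 0
  columnAlternating-vanishes A =
    vanishes-agreeingFrom n ℕ.≤-refl A (λ c → c) (λ r c n≤c → ⊥-elim (ℕ.<⇒≱ (toℕ<n c) n≤c))

det-firstRow-single : ∀ n (M : Matrix (suc n)) → (∀ j → j ≢ zero → M zero j ≡ + 0) →
                      det (suc n) M ≡ M zero zero * det n (λ r c → M (suc r) (suc c))
det-firstRow-single n M M₀ⱼ≡0 =
  trans (sumFin-single (suc n) (laplaceTerm M) zero (λ j j≢0 → laplaceTerm-zeroEntry M j (M₀ⱼ≡0 j j≢0)))
        (ℤ.*-identityˡ _)

det-1 : ∀ n → det n (1ᴹ n) ≡ + 1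
det-1 zero    = refl
det-1 (suc n) = begin
  det (suc n) (1ᴹ (suc n))
    ≡⟨ det-firstRow-single n (1ᴹ (suc n)) (λ j j≢0 → basisV-offDiag (j≢0 ∘ sym)) ⟩
  basisV {suc n} zero zero * det n (λ r c → basisV (suc r) (suc c))
    ≡⟨ cong₂ _*_ (basisV-diag {suc n} zero) (det-cong n _ (1ᴹ n) basisV-suc) ⟩
  + 1 * det n (1ᴹ n)
    ≡⟨ cong (+ 1 *_) (det-1 n) ⟩
  + 1 ∎
  where open ≡-Reasoning

det-unique : ∀ n (D : Matrix n → ℤ) → Extensional n D → ColumnLinear n D → ColumnAlternating n D →
             ∀ A → D A ≡ det n A * D (1ᴹ n)
det-unique n D D-ext D-lin D-alt A =
  trans (regroup (D A) (det n A * K))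
        (trans (cong (_+ det n A * K) (columnAlternating-vanishes E-ext E-lin E-alt E-1 A)) (ℤ.+-identityˡ _))
  where
  K = D (1ᴹ n)
  E : Matrix n → ℤ
  E M = D M - det n M * K
  regroup : ∀ x y → x ≡ (x - y) + y
  regroup = solve-∀
  E-ext : Extensional n E
  E-ext M N M≗N = cong₂ (λ x y → x - y * K) (D-ext M N M≗N) (det-cong n M N M≗N)
  E-lin : ColumnLinear n E
  E-lin j a M U V U≈M V≈M Mⱼ =
    trans (cong₂ (λ x y → x - y * K) (D-lin j a M U V U≈M V≈M Mⱼ) (det-columnLinear n j a M U V U≈M V≈M Mⱼ))
          (distrib a (D U) (D V) (det n U) (det n V) K)
    where
    distrib : ∀ a du dv eu ev k → (a * du + dv) - (a * eu + ev) * k ≡ a * (du - eu * k) + (dv - ev * k)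
    distrib = solve-∀
  E-alt : ColumnAlternating n E
  E-alt M i l i≢l cols = cong₂ (λ x y → x - y * K) (D-alt M i l i≢l cols) (det-columnAlternating n M i l i≢l cols)
  E-1 : E (1ᴹ n) ≡ + 0
  E-1 = trans (cong (λ x → K - x * K) (det-1 n)) (self-cancel K)
    where
    self-cancel : ∀ k → k - + 1 * k ≡ + 0
    self-cancel = solve-∀

det-*ᴹ : ∀ n (A B : Matrix n) → det n (A *ᴹ B) ≡ det n A * det n B
det-*ᴹ n A B = begin
  det n (A *ᴹ B)             ≡⟨ det-unique n D D-ext D-lin D-alt B ⟩
  det n B * det n (A *ᴹ 1ᴹ n) ≡⟨ cong (det n B *_) (det-cong n _ _ (λ r c → sumFin-*basisV n (A r) c)) ⟩
  det n B * det n A          ≡⟨ ℤ.*-comm (det n B) (det n A) ⟩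
  det n A * det n B          ∎
  where
  open ≡-Reasoning
  D : Matrix n → ℤ
  D M = det n (A *ᴹ M)
  left-mul-cong : ∀ {M N : Matrix n} → M ≗ᴹ N → A *ᴹ M ≗ᴹ A *ᴹ N
  left-mul-cong M≗N r c = sumFin-cong n (λ k → cong (A r k *_) (M≗N k c))
  D-ext : Extensional n D
  D-ext M N M≗N = det-cong n _ _ (left-mul-cong M≗N)
  D-lin : ColumnLinear n D
  D-lin j a M U V U≈M V≈M Mⱼ = det-columnLinear n j a (A *ᴹ M) (A *ᴹ U) (A *ᴹ V)
    (λ r c c≢j → sumFin-cong n (λ k → cong (A r k *_) (U≈M k c c≢j)))
    (λ r c c≢j → sumFin-cong n (λ k → cong (A r k *_) (V≈M k c c≢j)))
    (λ r → trans (sumFin-cong n (λ k → trans (cong (A r k *_) (Mⱼ k)) (distrib (A r k) a (U k j) (V k j))))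
                 (sumFin-linear n a (λ k → A r k * U k j) (λ k → A r k * V k j)))
    where
    distrib : ∀ x a u v → x * (a * u + v) ≡ a * (x * u) + x * v
    distrib = solve-∀
  D-alt : ColumnAlternating n D
  D-alt M i l i≢l cols =
    det-columnAlternating n (A *ᴹ M) i l i≢l (λ r → sumFin-cong n (λ k → cong (A r k *_) (cols k)))

x≡-x⇒x≡0 : ∀ {x} → x ≡ - x → x ≡ + 0
x≡-x⇒x≡0 {+ zero}     _  = refl
x≡-x⇒x≡0 {+ suc _}    ()
x≡-x⇒x≡0 {ℤ.-[1+ _ ]} ()

-- Multiplying on the left by J, which is 1 with columns i and l swapped, exchanges rows i and l.
det-rowAlternating : ∀ n M (i l : Fin n) → i ≢ l → (∀ c → M i c ≡ M l c) → det n M ≡ + 0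
det-rowAlternating n M i l i≢l rows = x≡-x⇒x≡0 (begin
  det n M             ≡⟨ det-cong n _ _ J*M≗M ⟨
  det n (J *ᴹ M)      ≡⟨ det-*ᴹ n J M ⟩
  det n J * det n M   ≡⟨ cong (_* det n M) det-J ⟩
  - + 1 * det n M     ≡⟨ ℤ.-1*i≡-i (det n M) ⟩
  - det n M           ∎)
  where
  open ≡-Reasoning
  τ = transpose i l
  J : Matrix n
  J = swapColumns (1ᴹ n) i l
  det-J : det n J ≡ - + 1
  det-J = trans (swapColumns-negates (det-cong n) (det-columnLinear n) i≢l
                   (λ N → det-columnAlternating n N i l i≢l) (1ᴹ n))
                (cong -_ (det-1 n))
  rows-swapped : ∀ r c → M (τ r) c ≡ M r c
  rows-swapped r c = by-cases (r ≟ i) (r ≟ l)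
    where
    by-cases : Dec (r ≡ i) → Dec (r ≡ l) → M (τ r) c ≡ M r c
    by-cases (yes refl) _          = trans (cong (λ x → M x c) (transpose-ˡ r l)) (sym (rows c))
    by-cases (no _)     (yes refl) = trans (cong (λ x → M x c) (transpose-ʳ i r)) (rows c)
    by-cases (no r≢i)   (no r≢l)   = cong (λ x → M x c) (transpose-≢ r≢i r≢l)
  J*M≗M : J *ᴹ M ≗ᴹ M
  J*M≗M r c = begin
    sumFin n (λ k → basisV r (τ k) * M k c)
      ≡⟨ sumFin-single n _ (τ r) (λ k k≢τr → trans (cong (_* M k c) (basisV-offDiag (r≢τk k≢τr))) (ℤ.*-zeroˡ (M k c))) ⟩
    basisV r (τ (τ r)) * M (τ r) c
      ≡⟨ cong₂ _*_ (trans (cong (basisV r) (transpose-involutive i l r)) (basisV-diag r)) (rows-swapped r c) ⟩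
    + 1 * M r c                              ≡⟨ ℤ.*-identityˡ (M r c) ⟩
    M r c                                    ∎
    where
    r≢τk : ∀ {k} → k ≢ τ r → r ≢ τ k
    r≢τk {k} k≢τr r≡τk = k≢τr (trans (sym (transpose-involutive i l k)) (cong τ (sym r≡τk)))

det-ᵀ : ∀ n (A : Matrix n) → det n (A ᵀ) ≡ det n A
det-ᵀ n A = begin
  det n (A ᵀ)                  ≡⟨ det-unique n D D-ext D-lin D-alt A ⟩
  det n A * det n (1ᴹ n ᵀ)
    ≡⟨ cong (det n A *_) (trans (det-cong n _ _ (λ r c → basisV-sym c r)) (det-1 n)) ⟩
  det n A * + 1                ≡⟨ ℤ.*-identityʳ (det n A) ⟩
  det n A                      ∎
  where
  open ≡-Reasoning
  D : Matrix n → ℤ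
  D M = det n (M ᵀ)
  D-ext : Extensional n D
  D-ext M N M≗N = det-cong n _ _ (λ r c → M≗N c r)
  D-lin : ColumnLinear n D
  D-lin j a M U V U≈M V≈M Mⱼ =
    det-rowLinear n j a (M ᵀ) (U ᵀ) (V ᵀ) (λ r c → U≈M c r) (λ r c → V≈M c r) Mⱼ
  D-alt : ColumnAlternating n D
  D-alt M = det-rowAlternating n (M ᵀ)

^∣-det : ∀ m n (M : Matrix n) → (∀ r c → + m Signed.∣ M r c) → + (m ^ n) Signed.∣ det n M
^∣-det m zero    M m∣M = Signed.divides (+ 1) refl
^∣-det m (suc n) M m∣M = ∣-sumFin (suc n) _ λ j →
  Signed.∣n⇒∣m*n (negOnePow (toℕ j))
    (∣-product (m∣M zero j) (^∣-det m n (minor M j) (λ r c → m∣M (suc r) (punchIn j c))))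
  where
  ∣-product : ∀ {x y} → + m Signed.∣ x → + (m ^ n) Signed.∣ y → + (m ^ suc n) Signed.∣ x * y
  ∣-product {x} {y} m∣x mⁿ∣y = Signed.∣ᵤ⇒∣
    (subst (m ^ suc n ℕ.∣_) (sym (ℤ.abs-* x y)) (ℕ.*-pres-∣ (Signed.∣⇒∣ᵤ m∣x) (Signed.∣⇒∣ᵤ mⁿ∣y)))

-- The trace form

module _ {n} (O : RingOfIntegers n) where
  open RingOfIntegers O

  gram : ∀ {r} → (Fin r → Vecℤ n) → Matrix r
  gram w i j = Tr O (mulC C (w i) (w j))

  private
    τ : Fin n → ℤ
    τ a = sumFin n (λ i → C a i i)

  mulC-basisV : ∀ a b c → mulC C (basisV a) (basisV b) c ≡ C a b c
  mulC-basisV a b c = trans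
    (sumFin-cong n (λ x → trans (sumFin-*ˡ n (basisV a x) (λ y → basisV b y * C x y c))
                                (cong (basisV a x *_) (sumFin-basisV* n (λ y → C x y c) b))))
    (sumFin-basisV* n (λ x → C x b c) a)

  Tr-expand : ∀ z → Tr O z ≡ sumFin n (λ a → z a * τ a)
  Tr-expand z = begin
    sumFin n (λ i → sumFin n (λ a → sumFin n (λ b → z a * (basisV i b * C a b i))))
      ≡⟨ sumFin-cong n (λ i → sumFin-cong n (λ a →
           trans (sumFin-*ˡ n (z a) _) (cong (z a *_) (sumFin-basisV* n (λ b → C a b i) i)))) ⟩
    sumFin n (λ i → sumFin n (λ a → z a * C a i i))  ≡⟨ sumFin-swap n n _ ⟩
    sumFin n (λ a → sumFin n (λ i → z a * C a i i))
      ≡⟨ sumFin-cong n (λ a → sumFin-*ˡ n (z a) (λ i → C a i i)) ⟩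
    sumFin n (λ a → z a * τ a)                       ∎
    where open ≡-Reasoning

  Tr-cong : ∀ {x y} → x ≐ y → Tr O x ≡ Tr O y
  Tr-cong {x} {y} x≐y =
    trans (Tr-expand x) (trans (sumFin-cong n (λ a → cong (_* τ a) (x≐y a))) (sym (Tr-expand y)))

  Tr-linear : ∀ a x y → Tr O (λ i → a * x i + y i) ≡ a * Tr O x + Tr O y
  Tr-linear a x y = begin
    Tr O (λ i → a * x i + y i)                          ≡⟨ Tr-expand (λ i → a * x i + y i) ⟩
    sumFin n (λ i → (a * x i + y i) * τ i)              ≡⟨ sumFin-cong n (λ i → distrib a (x i) (y i) (τ i)) ⟩
    sumFin n (λ i → a * (x i * τ i) + y i * τ i)        ≡⟨ sumFin-linear n a _ _ ⟩
    a * sumFin n (λ i → x i * τ i) + sumFin n (λ i → y i * τ i)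
      ≡⟨ cong₂ (λ u v → a * u + v) (Tr-expand x) (Tr-expand y) ⟨
    a * Tr O x + Tr O y                                 ∎
    where
    open ≡-Reasoning
    distrib : ∀ a x y t → (a * x + y) * t ≡ a * (x * t) + y * t
    distrib = solve-∀

  Tr-one : Tr O one ≡ + n
  Tr-one = trans (sumFin-cong n (λ i → trans (identity (basisV i) i) (basisV-diag i))) (sumFin-ones n)

  Tr-mulC : ∀ x y → Tr O (mulC C x y) ≡ sumFin n (λ a → sumFin n (λ b → x a * (y b * gram basisV a b)))
  Tr-mulC x y = begin
    Tr O (mulC C x y)
      ≡⟨ Tr-expand (mulC C x y) ⟩
    sumFin n (λ c → sumFin n (λ a → sumFin n (λ b → x a * (y b * C a b c))) * τ c)
      ≡⟨ sumFin-cong n (λ c → trans (sumFin-cong n (λ a → sumFin-*ʳ n _ (τ c))) (sumFin-*ʳ n _ (τ c))) ⟨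
    sumFin n (λ c → sumFin n (λ a → sumFin n (λ b → x a * (y b * C a b c) * τ c)))
      ≡⟨ trans (sumFin-swap n n _) (sumFin-cong n (λ a → sumFin-swap n n _)) ⟩
    sumFin n (λ a → sumFin n (λ b → sumFin n (λ c → x a * (y b * C a b c) * τ c)))
      ≡⟨ sumFin-cong n (λ a → sumFin-cong n (λ b → pull-out (x a) (y b) (λ c → C a b c))) ⟩
    sumFin n (λ a → sumFin n (λ b → x a * (y b * sumFin n (λ c → C a b c * τ c))))
      ≡⟨ sumFin-cong n (λ a → sumFin-cong n (λ b → cong (λ g → x a * (y b * g)) (gram-basis a b))) ⟨
    sumFin n (λ a → sumFin n (λ b → x a * (y b * gram basisV a b))) ∎
    where
    open ≡-Reasoning
    reassoc : ∀ u v c t → u * (v * c) * t ≡ u * (v * (c * t))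
    reassoc = solve-∀
    pull-out : ∀ u v (f : Fin n → ℤ) →
               sumFin n (λ c → u * (v * f c) * τ c) ≡ u * (v * sumFin n (λ c → f c * τ c))
    pull-out u v f = trans (sumFin-cong n (λ c → reassoc u v (f c) (τ c)))
                           (trans (sumFin-*ˡ n u _) (cong (u *_) (sumFin-*ˡ n v _)))
    gram-basis : ∀ a b → gram basisV a b ≡ sumFin n (λ c → C a b c * τ c)
    gram-basis a b = trans (Tr-expand (mulC C (basisV a) (basisV b)))
                           (sumFin-cong n (λ c → cong (_* τ c) (mulC-basisV a b c)))

  gram-congruence : ∀ (W : Matrix n) → gram W ≗ᴹ W *ᴹ gram basisV *ᴹ W ᵀ
  gram-congruence W r c = trans (Tr-mulC (W r) (W c)) (trans (sumFin-swap n n _)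
    (sumFin-cong n (λ b → trans (sumFin-cong n (λ a → reassoc (W r a) (W c b) (gram basisV a b)))
                                (sumFin-*ʳ n _ (W c b)))))
    where
    reassoc : ∀ x y g → x * (y * g) ≡ x * g * y
    reassoc = solve-∀

  det-gram : ∀ (W : Matrix n) → det n (gram W) ≡ det n W * det n W * discK O
  det-gram W = begin
    det n (gram W)                              ≡⟨ det-cong n _ _ (gram-congruence W) ⟩
    det n (W *ᴹ gram basisV *ᴹ W ᵀ)             ≡⟨ det-*ᴹ n _ _ ⟩
    det n (W *ᴹ gram basisV) * det n (W ᵀ)      ≡⟨ cong₂ _*_ (det-*ᴹ n _ _) (det-ᵀ n W) ⟩
    det n W * discK O * det n W                 ≡⟨ reorder (det n W) (discK O) ⟩
    det n W * det n W * discK O                 ∎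
    where
    open ≡-Reasoning
    reorder : ∀ w d → w * d * w ≡ w * w * d
    reorder = solve-∀

-- The trace-zero sublattice

det-unitRowsBelow : ∀ k (v : Fin (suc k) → ℤ) → det (suc k) (v ∷ λ i → basisV (suc i)) ≡ v zero
det-unitRowsBelow k v = begin
  det (suc k) T                                 ≡⟨ det-ᵀ (suc k) T ⟨
  det (suc k) (T ᵀ)                             ≡⟨ det-firstRow-single k (T ᵀ) first-column ⟩
  v zero * det k (λ r c → basisV (suc c) (suc r))
    ≡⟨ cong (v zero *_) (det-cong k _ (1ᴹ k) (λ r c → trans (basisV-suc c r) (basisV-sym c r))) ⟩
  v zero * det k (1ᴹ k)                         ≡⟨ cong (v zero *_) (det-1 k) ⟩
  v zero * + 1                                  ≡⟨ ℤ.*-identityʳ (v zero) ⟩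
  v zero                                        ∎
  where
  open ≡-Reasoning
  T : Matrix (suc k)
  T = v ∷ λ i → basisV (suc i)
  first-column : ∀ j → j ≢ zero → T j zero ≡ + 0
  first-column zero    j≢0 = ⊥-elim (j≢0 refl)
  first-column (suc i) _   = basisV-offDiag {i = suc i} {zero} λ ()

m*n≡1⇒n*n≡1 : ∀ x y → x * y ≡ + 1 → y * y ≡ + 1
m*n≡1⇒n*n≡1 x y xy≡1
  with ℕ.m*n≡1⇒n≡1 ℤ.∣ x ∣ ℤ.∣ y ∣ (trans (sym (ℤ.abs-* x y)) (cong ℤ.∣_∣ xy≡1))
m*n≡1⇒n*n≡1 x (+ 1)       _ | refl = refl
m*n≡1⇒n*n≡1 x ℤ.-[1+ 0 ] _ | refl = refl

rescale : ∀ {a d s m n : ℤ} → s ≢ + 0 → s * m ≡ n → n * a ≡ s * s * d → a * (m * m) ≡ d * n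
rescale {a} {d} {s} {m} {n} s≢0 sm≡n na≡ssd = begin
  a * (m * m)   ≡⟨ rearrange a m ⟩
  m * (m * a)   ≡⟨ cong (m *_) ma≡sd ⟩
  m * (s * d)   ≡⟨ rearrange′ m s d ⟩
  s * m * d     ≡⟨ cong (_* d) sm≡n ⟩
  n * d         ≡⟨ ℤ.*-comm n d ⟩
  d * n         ∎
  where
  open ≡-Reasoning
  rearrange : ∀ a m → a * (m * m) ≡ m * (m * a)
  rearrange = solve-∀
  rearrange′ : ∀ m s d → m * (s * d) ≡ s * m * d
  rearrange′ = solve-∀
  ma≡sd : m * a ≡ s * d
  ma≡sd = ℤ.*-cancelˡ-≡ s (m * a) (s * d) {{ℤ.≢-nonZero s≢0}} (begin
    s * (m * a)  ≡⟨ ℤ.*-assoc s m a ⟨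
    s * m * a    ≡⟨ cong (_* a) sm≡n ⟩
    n * a        ≡⟨ na≡ssd ⟩
    s * s * d    ≡⟨ ℤ.*-assoc s s d ⟩
    s * (s * d)  ∎)

powerFree-divisor≡1 : ∀ {m n d} → 0 < m → + (m ^ n) ∣ d → (∀ a → 1 < a → ¬ (+ (a ^ n)) ∣ d) → m ≡ 1
powerFree-divisor≡1 {suc zero}    _ _    _    = refl
powerFree-divisor≡1 {suc (suc m)} _ mⁿ∣d free =
  ⊥-elim (free (suc (suc m)) (ℕ.s≤s (ℕ.s≤s ℕ.z≤n)) mⁿ∣d)

module TraceZeroSublattice {k : ℕ} (O : RingOfIntegers (suc k)) (m : ℕ) (m∣Tr : ∀ x → + m ∣ Tr O x)
                           (x₀ : Vecℤ (suc k)) (Tr-x₀ : Tr O x₀ ≡ + m)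
                           {b : Fin k → Vecℤ (suc k)} (b-basis : IsTraceZeroBasis O b) where
  open RingOfIntegers O
  open IsTraceZeroBasis b-basis

  R : Matrix (suc k)
  R = x₀ ∷ b

  coordinates : ∀ y → ∃ λ (v : Vecℤ (suc k)) →
                (Tr O y ≡ v zero * + m) × (∀ a → y a ≡ sumFin (suc k) (λ i → v i * R i a))
  coordinates y with Signed.∣ᵤ⇒∣ (m∣Tr y)
  ... | Signed.divides t Tr-y≡tm =
    (t ∷ proj₁ w∈span) , Tr-y≡tm , λ a → trans (split a) (cong (_+_ (t * x₀ a)) (proj₂ w∈span a))
    where
    w : Vecℤ (suc k)
    w a = - t * x₀ a + y a
    cancel : ∀ t m → - t * m + t * m ≡ + 0
    cancel = solve-∀
    w∈span = spans w (trans (Tr-linear O (- t) x₀ y)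
                            (trans (cong₂ (λ u v → - t * u + v) Tr-x₀ Tr-y≡tm) (cancel t (+ m))))
    regroup : ∀ t x y → y ≡ t * x + (- t * x + y)
    regroup = solve-∀
    split : ∀ a → y a ≡ t * x₀ a + w a
    split a = regroup t (x₀ a) (y a)

  det-R-unit : det (suc k) R * det (suc k) R ≡ + 1
  det-R-unit = m*n≡1⇒n*n≡1 (det (suc k) Q) (det (suc k) R)
    (trans (sym (det-*ᴹ (suc k) Q R)) (trans (det-cong (suc k) _ _ QR≗1) (det-1 (suc k))))
    where
    Q : Matrix (suc k)
    Q j = proj₁ (coordinates (basisV j))
    QR≗1 : Q *ᴹ R ≗ᴹ 1ᴹ (suc k)
    QR≗1 j a = sym (proj₂ (proj₂ (coordinates (basisV j))) a)

  s : ℤ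
  s = proj₁ (coordinates one) zero

  s*m≡n : s * + m ≡ + suc k
  s*m≡n = trans (sym (proj₁ (proj₂ (coordinates one)))) (Tr-one O)

  s≢0 : s ≢ + 0
  s≢0 s≡0 with trans (sym s*m≡n) (cong (_* + m) s≡0)
  ... | ()

  R₁ : Matrix (suc k)
  R₁ = one ∷ b

  det-R₁ : det (suc k) R₁ ≡ s * det (suc k) R
  det-R₁ = begin
    det (suc k) R₁              ≡⟨ det-cong (suc k) _ _ TR≗R₁ ⟨
    det (suc k) (T *ᴹ R)        ≡⟨ det-*ᴹ (suc k) T R ⟩
    det (suc k) T * det (suc k) R ≡⟨ cong (_* det (suc k) R) (det-unitRowsBelow k (proj₁ (coordinates one))) ⟩
    s * det (suc k) R           ∎
    where
    open ≡-Reasoning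
    T : Matrix (suc k)
    T = proj₁ (coordinates one) ∷ λ i → basisV (suc i)
    TR≗R₁ : T *ᴹ R ≗ᴹ R₁
    TR≗R₁ zero    a = sym (proj₂ (proj₂ (coordinates one)) a)
    TR≗R₁ (suc i) a = sumFin-basisV* (suc k) (λ j → R j a) (suc i)

  det-gram-R₁ : det (suc k) (gram O R₁) ≡ + suc k * det k (gram O b)
  det-gram-R₁ = trans (det-firstRow-single k (gram O R₁) first-row)
                      (cong (_* det k (gram O b)) (trans (Tr-cong O (identity one)) (Tr-one O)))
    where
    first-row : ∀ j → j ≢ zero → gram O R₁ zero j ≡ + 0
    first-row zero    j≢0 = ⊥-elim (j≢0 refl)
    first-row (suc i) _   = trans (Tr-cong O (identity (b i))) (inTraceZero i)

  det-gram-b-scaling : det k (gram O b) * (+ m * + m) ≡ discK O * + suc k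
  det-gram-b-scaling = rescale s≢0 s*m≡n (begin
    + suc k * det k (gram O b)                      ≡⟨ det-gram-R₁ ⟨
    det (suc k) (gram O R₁)                         ≡⟨ det-gram O R₁ ⟩
    det (suc k) R₁ * det (suc k) R₁ * discK O       ≡⟨ cong (λ x → x * x * discK O) det-R₁ ⟩
    s * r * (s * r) * discK O                       ≡⟨ regroup s r (discK O) ⟩
    s * s * discK O * (r * r)                       ≡⟨ cong (s * s * discK O *_) det-R-unit ⟩
    s * s * discK O * + 1                           ≡⟨ ℤ.*-identityʳ _ ⟩
    s * s * discK O                                 ∎)
    where
    open ≡-Reasoning
    r = det (suc k) R
    regroup : ∀ s r d → s * r * (s * r) * d ≡ s * s * d * (r * r)
    regroup = solve-∀

  mⁿ∣discK : + (m ^ suc k) ∣ discK O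
  mⁿ∣discK = Signed.∣⇒∣ᵤ
    (^∣-det m (suc k) (gram O basisV) (λ r c → Signed.∣ᵤ⇒∣ (m∣Tr (mulC C (basisV r) (basisV c)))))

lemma4p2 : (k : ℕ) (O : RingOfIntegers (suc k)) (m : ℕ) → 0 < m →
           (∀ x → (+ m) ∣ Tr O x) → (∃ λ x → Tr O x ≡ + m) →
           (b : Fin k → Vecℤ (suc k)) → IsTraceZeroBasis O b →
           (discΦ O b * (+ m * + m)
              ≡ negOnePow ((suc k ∸ 1) Data.Nat.* (suc k ∸ 2) / 2) * (discK O * + suc k))
           × ((∀ (a : ℕ) → 1 < a → ¬ ((+ (a ^ suc k)) ∣ discK O)) →
              discΦ O b ≡ negOnePow ((suc k ∸ 1) Data.Nat.* (suc k ∸ 2) / 2) * (discK O * + suc k))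
lemma4p2 k O m 0<m m∣Tr (x₀ , Tr-x₀) b b-basis = scaled , powerFree
  where
  open TraceZeroSublattice O m m∣Tr x₀ Tr-x₀ b-basis
  -- σ reduces to the sign negOnePow (k * (k ∸ 1) / 2) in discΦ O b = discQF k (gram O b).
  σ = negOnePow ((suc k ∸ 1) Data.Nat.* (suc k ∸ 2) / 2)
  scaled : discΦ O b * (+ m * + m) ≡ σ * (discK O * + suc k)
  scaled = trans (ℤ.*-assoc σ _ _) (cong (σ *_) det-gram-b-scaling)
  powerFree : (∀ a → 1 < a → ¬ ((+ (a ^ suc k)) ∣ discK O)) → discΦ O b ≡ σ * (discK O * + suc k)
  powerFree free = trans (sym (ℤ.*-identityʳ (discΦ O b)))
    (subst (λ m → discΦ O b * (+ m * + m) ≡ σ * (discK O * + suc k))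
           (powerFree-divisor≡1 {n = suc k} {discK O} 0<m mⁿ∣discK free) scaled)
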